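{- Let $S$ be a tree, and let $v$ be a vertex of $S$ with degree two, with neighbours $u,w$. Let $T$ be the tree obtained from $S$ by deleting $v$ and adding a new edge joining $u$ and $w$. If $T$ is upright then $S$ is upright.
   Context: For a graph $G$ and $A,B\subseteq V(G)$, $D_G(A,B)$ is the set of edges of $G$ with one end in $A\setminus B$ and one end in $B\setminus A$, and $D_G(X)$ is the set of edges with one end in $X$ and the other in $V(G)\setminus X$. A bias in a graph $S$ is a set $\mathcal{B}$ of subsets of $V(S)$ such that: (i) if $A\in\mathcal{B}$ then $A\neq\emptyset, V(S)$; (ii) if $A,B\in\mathcal{B}$ and $D_S(A,B)=\emptyset$ then both $A\cap B$ and $A\cup B$ belong to $\mathcal{B}\cup\{\emptyset,V(S)\}$; (iii) if $A,B\in\mathcal{B}$ and $|D_S(A,B)|=1$ then at least one of $A\cap B$, $A\cup B$ belongs to $\mathcal{B}\cup\{\emptyset,V(S)\}$. A directing of a graph assigns to each edge one of its ends as its head, producing a digraph; for a digraph $S'$, $D^+_{S'}(X)$ is the set of edges with tail in $X$ and head outside $X$, and $D^-_{S'}(X)$ the set of edges with head in $X$ and tail outside $X$. A forest $S$ is upright if for every bias $\mathcal{B}$ in $S$ such that $|D_S(X)|\ge 2$ for each $X\in\mathcal{B}$, there is a directing of $S$, forming a digraph $S'$, such that $D^+_{S'}(X)\neq\emptyset$ and $D^-_{S'}(X)\neq\emptyset$ for each $X\in\mathcal{B}$. -}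

module Defs where

open import Data.Nat using (ℕ; zero; suc)
open import Data.Bool using (Bool; true; false; _∨_; _∧_)
open import Data.Fin using (Fin; zero; suc; punchIn; inject₁; fromℕ; _≟_)
open import Data.Fin.Subset using (Subset; _∈_; _∉_; _∩_; _∪_; _─_; ⊥; ⊤)
open import Data.Product using (Σ; _×_; _,_; ∃; ∃-syntax)
open import Data.Sum using (_⊎_)
open import Relation.Binary.PropositionalEquality using (_≡_; _≢_)
open import Relation.Nullary using (¬_; does)
open import Function.Definitions using (Injective)

Graph : ℕ → Set
Graph n = Fin n → Fin n → Bool

Adj : ∀ {n} → Graph n → Fin n → Fin n → Set
Adj G a b = G a b ≡ true

IsSimple : ∀ {n} → Graph n → Set
IsSimple {n} G = (∀ a b → G a b ≡ G b a) × (∀ a → G a a ≡ false)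

data Walk {n} (G : Graph n) : Fin n → Fin n → Set where
  here : ∀ {a} → Walk G a a
  step : ∀ {a b c} → Adj G a b → Walk G b c → Walk G a c

Connected : ∀ {n} → Graph n → Set
Connected {n} G = ∀ (a b : Fin n) → Walk G a b

Cycle : ∀ {n} → Graph n → Set
Cycle {n} G = Σ ℕ λ k → Σ (Fin (suc (suc (suc k))) → Fin n) λ f →
    Injective _≡_ _≡_ f
  × (∀ (i : Fin (suc (suc k))) → Adj G (f (inject₁ i)) (f (suc i)))
  × Adj G (f (fromℕ (suc (suc k)))) (f zero)

IsForest : ∀ {n} → Graph n → Set
IsForest G = IsSimple G × ¬ Cycle G

IsTree : ∀ {n} → Graph n → Set
IsTree G = IsSimple G × Connected G × ¬ Cycle G

SetOfSubsets : ℕ → Set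
SetOfSubsets n = Subset n → Bool

_∈B_ : ∀ {n} → Subset n → SetOfSubsets n → Set
X ∈B 𝓑 = 𝓑 X ≡ true

_∈B⁺_ : ∀ {n} → Subset n → SetOfSubsets n → Set
X ∈B⁺ 𝓑 = X ∈B 𝓑 ⊎ X ≡ ⊥ ⊎ X ≡ ⊤

-- An edge of D_G(A,B) is an unordered edge {a,b} with a ∈ A∖B, b ∈ B∖A; it
-- is represented uniquely by the ordered pair (a , b) with a ∈ A∖B.
InD₂ : ∀ {n} → Graph n → Subset n → Subset n → Fin n × Fin n → Set
InD₂ G A B (a , b) = a ∈ (A ─ B) × b ∈ (B ─ A) × Adj G a b

D₂Empty : ∀ {n} → Graph n → Subset n → Subset n → Set
D₂Empty G A B = ∀ e → ¬ InD₂ G A B e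

D₂Single : ∀ {n} → Graph n → Subset n → Subset n → Set
D₂Single G A B = Σ _ λ e → InD₂ G A B e × (∀ e' → InD₂ G A B e' → e' ≡ e)

-- An edge of D_G(X) is represented uniquely by (a , b) with a ∈ X, b ∉ X.
InD : ∀ {n} → Graph n → Subset n → Fin n × Fin n → Set
InD G X (a , b) = a ∈ X × b ∉ X × Adj G a b

DAtLeast2 : ∀ {n} → Graph n → Subset n → Set
DAtLeast2 G X = Σ _ λ e → Σ _ λ e' → InD G X e × InD G X e' × e ≢ e'

IsBias : ∀ {n} → Graph n → SetOfSubsets n → Set
IsBias G 𝓑 =
    (∀ A → A ∈B 𝓑 → A ≢ ⊥ × A ≢ ⊤)
  × (∀ A B → A ∈B 𝓑 → B ∈B 𝓑 → D₂Empty G A B → (A ∩ B) ∈B⁺ 𝓑 × (A ∪ B) ∈B⁺ 𝓑)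
  × (∀ A B → A ∈B 𝓑 → B ∈B 𝓑 → D₂Single G A B → (A ∩ B) ∈B⁺ 𝓑 ⊎ (A ∪ B) ∈B⁺ 𝓑)

-- A directing of G: arc a b = true means the edge ab has tail a and head b.
-- Every edge gets exactly one of its two orientations; non-edges get none.
IsDirecting : ∀ {n} → Graph n → (Fin n → Fin n → Bool) → Set
IsDirecting G arc =
    (∀ a b → Adj G a b → (arc a b ≡ true × arc b a ≡ false) ⊎ (arc a b ≡ false × arc b a ≡ true))
  × (∀ a b → arc a b ≡ true → Adj G a b)

OutNonempty : ∀ {n} → (Fin n → Fin n → Bool) → Subset n → Set
OutNonempty arc X = Σ _ λ a → Σ _ λ b → a ∈ X × b ∉ X × arc a b ≡ true

InNonempty : ∀ {n} → (Fin n → Fin n → Bool) → Subset n → Set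
InNonempty arc X = Σ _ λ a → Σ _ λ b → a ∈ X × b ∉ X × arc b a ≡ true

Upright : ∀ {n} → Graph n → Set
Upright {n} G =
  ∀ (𝓑 : SetOfSubsets n) → IsBias G 𝓑 → (∀ X → X ∈B 𝓑 → DAtLeast2 G X) →
  Σ (Fin n → Fin n → Bool) λ arc → IsDirecting G arc ×
    (∀ X → X ∈B 𝓑 → OutNonempty arc X × InNonempty arc X)

-- Vertices of the result are Fin n, identified with V(S) ∖ {v} via punchIn v.
isPair : ∀ {n} → Fin n → Fin n → Fin n → Fin n → Bool
isPair u w a b = (does (a ≟ u) ∧ does (b ≟ w)) ∨ (does (a ≟ w) ∧ does (b ≟ u))

suppress : ∀ {n} → Graph (suc n) → Fin (suc n) → Fin n → Fin n → Graph n
suppress S v u w a b = S (punchIn v a) (punchIn v b) ∨ isPair u w a b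

module Submission where

-- Let v have exactly the neighbours u, w in a simple graph S, with u and w not
-- adjacent (automatic in a tree, where u, v, w would form a triangle), and let
-- T be S with v suppressed.  Call X ⊆ V(S) tame if it does not split v off,
-- i.e. X ∩ {v, u, w} is neither {v} nor {u, w}.  Each edge of S has an image
-- in T: itself if it avoids v, and uw, oriented along u–v–w, if it meets v.
-- For tame sets the image map sends edges of D_S to edges of D_T, and it is
-- injective because an edge is recovered from its image and the side of v.
--
-- Given a bias 𝓑 of S whose members have |D_S| ≥ 2, the restrictions to V(T)
-- of its tame members form a bias 𝓑' of T whose members have |D_T| ≥ 2
-- (module Restricted).  The bias conditions come down to facts about the
-- membership bits of v, u, w; the one six-variable fact is checked by
-- evaluating a Boolean formula at all 64 assignments.  A directing of T that
-- is good for 𝓑' lifts to S by orienting every edge as its image (module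
-- Lift): tame members of 𝓑 inherit their in- and out-arcs from T, and members
-- splitting v off are crossed both ways by the directed path u → v → w (or
-- w → v → u).

open import Defs
open import Data.Nat using (ℕ; zero; suc)
open import Data.Bool using (Bool; true; false; _∨_; _∧_; not; _xor_; if_then_else_)
open import Data.Bool.Properties using (¬-not; ∨-zeroʳ)
open import Data.Fin using (Fin; zero; suc; punchIn; punchOut; _≟_; inject₁)
open import Data.Fin.Properties
  using (punchIn-injective; punchInᵢ≢i; punchIn-punchOut; punchOut-punchIn; punchOut-cong)
open import Data.Fin.Subset using (Subset; _∈_; _∉_; _∩_; _∪_; _─_; ⊥; ⊤)
open import Data.Fin.Subset.Properties using (∩-comm; ∪-comm; x∈p∧x∉q⇒x∈p─q; p─q⊆p)
open import Data.Vec using (Vec; lookup; tabulate; insertAt; replicate; zipWith)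
open import Data.Vec.Properties
  using (lookup∘tabulate; tabulate∘lookup; tabulate-cong; insertAt-lookup; insertAt-punchIn;
         lookup-zipWith; lookup-replicate; lookup⇒[]=; []=⇒lookup)
open import Data.Product using (Σ; _×_; _,_; proj₁; proj₂; swap)
open import Data.Sum using (_⊎_; inj₁; inj₂)
open import Data.Empty using (⊥-elim)
open import Relation.Binary.PropositionalEquality
open import Relation.Nullary using (¬_; does; yes; no)
open import Relation.Nullary.Decidable using (dec-true; dec-false)
open import Function using (_∘_)

∧-true : ∀ {a b} → a ∧ b ≡ true → a ≡ true × b ≡ true
∧-true {true} {true} _ = refl , refl

∨-true : ∀ {a b} → a ∨ b ≡ true → a ≡ true ⊎ b ≡ true
∨-true {true}  _ = inj₁ refl
∨-true {false} h = inj₂ h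

not-true : ∀ {a} → not a ≡ true → a ≡ false
not-true {false} _ = refl

not-false : ∀ {a} → not a ≡ false → a ≡ true
not-false {true} _ = refl

true≢false : ∀ {A : Set} → true ≡ false → A
true≢false ()

infixr 4 _⇒_
_⇒_ : Bool → Bool → Bool
true  ⇒ b = b
false ⇒ _ = true

⇒-elim : ∀ {a b} → (a ⇒ b) ≡ true → a ≡ true → b ≡ true
⇒-elim h refl = h

BoolFun : ℕ → Set
BoolFun zero    = Bool
BoolFun (suc k) = Bool → BoolFun k

Valid : (k : ℕ) → BoolFun k → Set
Valid zero    b = b ≡ true
Valid (suc k) f = ∀ b → Valid k (f b)

valid? : (k : ℕ) → BoolFun k → Bool
valid? zero    b = b
valid? (suc k) f = valid? k (f false) ∧ valid? k (f true)

valid?-sound : (k : ℕ) (f : BoolFun k) → valid? k f ≡ true → Valid k f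
valid?-sound zero    b h       = h
valid?-sound (suc k) f h false = valid?-sound k (f false) (proj₁ (∧-true h))
valid?-sound (suc k) f h true  = valid?-sound k (f true)  (proj₂ (∧-true h))

splits : (xv xu xw : Bool) → Bool
splits xv xu xw = (xv xor xu) ∧ (xv xor xw)

unsplit-u : ∀ {xv xu xw} b → splits xv xu xw ≡ false → xv ≡ b → xu ≡ not b → xw ≡ b
unsplit-u {xw = true}  true  _  refl refl = refl
unsplit-u {xw = false} false _  refl refl = refl
unsplit-u {xw = false} true  () refl refl
unsplit-u {xw = true}  false () refl refl

unsplit-w : ∀ {xv xu xw} b → splits xv xu xw ≡ false → xv ≡ b → xw ≡ not b → xu ≡ b
unsplit-w {xu = true}  true  _  refl refl = refl
unsplit-w {xu = false} false _  refl refl = refl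
unsplit-w {xu = false} true  () refl refl
unsplit-w {xu = true}  false () refl refl

unsplit-both : ∀ {xv} b → splits xv b b ≡ false → xv ≡ b
unsplit-both {true}  true  _  = refl
unsplit-both {false} false _  = refl
unsplit-both {true}  false ()
unsplit-both {false} true  ()

split-sides : ∀ xv {xu xw} → splits xv xu xw ≡ true → xu ≡ not xv × xw ≡ not xv
split-sides true  {false} {false} _ = refl , refl
split-sides false {true}  {true}  _ = refl , refl

splits-outside : ∀ x → splits x false false ≡ x
splits-outside true  = refl
splits-outside false = refl

splits-inside : ∀ x → splits x true true ≡ not x
splits-inside true  = refl
splits-inside false = refl

no-crossing-bits : ∀ {au aw bw bu} →
  ¬ ((au ≡ true × aw ≡ false) × (bw ≡ true × bu ≡ false)) →
  not (au ∧ not aw ∧ bw ∧ not bu) ≡ true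
no-crossing-bits {true}  {false} {true}  {false} h = ⊥-elim (h ((refl , refl) , (refl , refl)))
no-crossing-bits {false}                         _ = refl
no-crossing-bits {true}  {true}                  _ = refl
no-crossing-bits {true}  {false} {false}         _ = refl
no-crossing-bits {true}  {false} {true}  {true}  _ = refl

meet-join-law : BoolFun 6
meet-join-law av au aw bv bu bw =
  not (splits av au aw) ⇒ not (splits bv bu bw) ⇒
  not (au ∧ not aw ∧ bw ∧ not bu) ⇒ not (aw ∧ not au ∧ bu ∧ not bw) ⇒
  not (splits (av ∧ bv) (au ∧ bu) (aw ∧ bw)) ∧ not (splits (av ∨ bv) (au ∨ bu) (aw ∨ bw))

meet-join-valid : Valid 6 meet-join-law
meet-join-valid = valid?-sound 6 meet-join-law refl

meet-join-unsplit : ∀ av au aw bv bu bw → splits av au aw ≡ false → splits bv bu bw ≡ false →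
  ¬ ((au ≡ true × aw ≡ false) × (bw ≡ true × bu ≡ false)) →
  ¬ ((aw ≡ true × au ≡ false) × (bu ≡ true × bw ≡ false)) →
  splits (av ∧ bv) (au ∧ bu) (aw ∧ bw) ≡ false ×
  splits (av ∨ bv) (au ∨ bu) (aw ∨ bw) ≡ false
meet-join-unsplit av au aw bv bu bw sA sB ¬uw ¬wu =
  let meet , join = ∧-true (⇒-elim (⇒-elim (⇒-elim (⇒-elim (meet-join-valid av au aw bv bu bw)
                      (cong not sA)) (cong not sB)) (no-crossing-bits ¬uw)) (no-crossing-bits ¬wu))
  in not-true meet , not-true join

module _ {m : ℕ} where

  ∈⇒true : ∀ {x : Fin m} {X} → x ∈ X → lookup X x ≡ true
  ∈⇒true = []=⇒lookup

  true⇒∈ : ∀ {x : Fin m} {X} → lookup X x ≡ true → x ∈ X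
  true⇒∈ = lookup⇒[]= _ _

  ∉⇒false : ∀ {x : Fin m} {X} → x ∉ X → lookup X x ≡ false
  ∉⇒false x∉X = ¬-not (x∉X ∘ true⇒∈)

  false⇒∉ : ∀ {x : Fin m} {X} → lookup X x ≡ false → x ∉ X
  false⇒∉ x-out x∈X = true≢false (trans (sym (∈⇒true x∈X)) x-out)

  ∈─⇒∉ : ∀ {x : Fin m} {X Y} → x ∈ X ─ Y → x ∉ Y
  ∈─⇒∉ {x} {X} {Y} x∈X─Y x∈Y
    with trans (sym (lookup-zipWith _ x X Y)) (∈⇒true x∈X─Y)
  ... | eq rewrite ∈⇒true x∈Y = true≢false (sym eq)

  Leaves : Subset m → Fin m × Fin m → Set
  Leaves X (x , y) = lookup X x ≡ true × lookup X y ≡ false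

  Crosses : Subset m → Subset m → Fin m × Fin m → Set
  Crosses A B (x , y) = Leaves A (x , y) × Leaves B (y , x)

  InD⇒Leaves : ∀ (G : Graph m) X {x y} → InD G X (x , y) → Leaves X (x , y) × Adj G x y
  InD⇒Leaves _ _ (x∈ , y∉ , xy) = (∈⇒true x∈ , ∉⇒false y∉) , xy

  Leaves⇒InD : ∀ (G : Graph m) X {x y} → Leaves X (x , y) → Adj G x y → InD G X (x , y)
  Leaves⇒InD _ _ (x∈ , y∉) xy = true⇒∈ x∈ , false⇒∉ y∉ , xy

  InD₂⇒Crosses : ∀ (G : Graph m) A B {x y} →
    InD₂ G A B (x , y) → Crosses A B (x , y) × Adj G x y
  InD₂⇒Crosses _ A B (x∈A─B , y∈B─A , xy) =
    ( (∈⇒true (p─q⊆p A B x∈A─B) , ∉⇒false (∈─⇒∉ y∈B─A))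
    , (∈⇒true (p─q⊆p B A y∈B─A) , ∉⇒false (∈─⇒∉ x∈A─B)) ) , xy

  Crosses⇒InD₂ : ∀ (G : Graph m) A B {x y} →
    Crosses A B (x , y) → Adj G x y → InD₂ G A B (x , y)
  Crosses⇒InD₂ _ _ _ ((xA , yA) , (yB , xB)) xy =
    x∈p∧x∉q⇒x∈p─q (true⇒∈ xA) (false⇒∉ xB) ,
    x∈p∧x∉q⇒x∈p─q (true⇒∈ yB) (false⇒∉ yA) , xy

  crossing-swap : ∀ {G : Graph m} {A B x y} → (∀ {x y} → Adj G x y → Adj G y x) →
    InD₂ G B A (x , y) → InD₂ G A B (y , x)
  crossing-swap sym-G (x∈ , y∈ , xy) = y∈ , x∈ , sym-G xy

  vec-ext : ∀ {A : Set} {xs ys : Vec A m} → (∀ i → lookup xs i ≡ lookup ys i) → xs ≡ ys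
  vec-ext {xs = xs} {ys} eq =
    trans (sym (tabulate∘lookup xs)) (trans (tabulate-cong eq) (tabulate∘lookup ys))

triangle : ∀ {m} {G : Graph m} {a b c} → a ≢ b → b ≢ c → a ≢ c →
  Adj G a b → Adj G b c → Adj G c a → Cycle G
triangle {m} {G} {a} {b} {c} a≢b b≢c a≢c ab bc ca = 0 , f , f-injective , path , ca
  where
  f : Fin 3 → Fin m
  f zero             = a
  f (suc zero)       = b
  f (suc (suc zero)) = c
  f-injective : ∀ {i j} → f i ≡ f j → i ≡ j
  f-injective {zero}             {zero}             _ = refl
  f-injective {suc zero}         {suc zero}         _ = refl
  f-injective {suc (suc zero)}   {suc (suc zero)}   _ = refl
  f-injective {zero}             {suc zero}         e = ⊥-elim (a≢b e)
  f-injective {zero}             {suc (suc zero)}   e = ⊥-elim (a≢c e)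
  f-injective {suc zero}         {zero}             e = ⊥-elim (a≢b (sym e))
  f-injective {suc zero}         {suc (suc zero)}   e = ⊥-elim (b≢c e)
  f-injective {suc (suc zero)}   {zero}             e = ⊥-elim (a≢c (sym e))
  f-injective {suc (suc zero)}   {suc zero}         e = ⊥-elim (b≢c (sym e))
  path : ∀ (i : Fin 2) → Adj G (f (inject₁ i)) (f (suc i))
  path zero       = ab
  path (suc zero) = bc

module Suppression
  {n : ℕ} (S : Graph (suc n)) (v : Fin (suc n)) (u w : Fin n)
  (simple : IsSimple S)
  (v~u : Adj S v (punchIn v u)) (v~w : Adj S v (punchIn v w)) (u≢w : u ≢ w)
  (degree-two : ∀ x → Adj S v x → x ≡ punchIn v u ⊎ x ≡ punchIn v w)
  (u≁w : ¬ Adj S (punchIn v u) (punchIn v w))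
  where

  pu pw : Fin (suc n)
  pu = punchIn v u
  pw = punchIn v w

  T : Graph n
  T = suppress S v u w

  S-sym : ∀ {x y} → Adj S x y → Adj S y x
  S-sym {x} {y} xy = trans (proj₁ simple y x) xy

  S-irrefl : ∀ {x} → ¬ Adj S x x
  S-irrefl {x} xx = true≢false (trans (sym xx) (proj₂ simple x))

  v≢punchIn : ∀ a → v ≢ punchIn v a
  v≢punchIn a = punchInᵢ≢i v a ∘ sym

  pu≢pw : pu ≢ pw
  pu≢pw = u≢w ∘ punchIn-injective v u w

  S-uw : S pu pw ≡ false
  S-uw = ¬-not u≁w

  S-wu : S pw pu ≡ false
  S-wu = ¬-not (u≁w ∘ S-sym)

  S⇒T : ∀ {a b} → Adj S (punchIn v a) (punchIn v b) → Adj T a b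
  S⇒T {a} {b} ab = cong (_∨ isPair u w a b) ab

  T-uw : Adj T u w
  T-uw rewrite dec-true (u ≟ u) refl | dec-true (w ≟ w) refl = ∨-zeroʳ _

  T-wu : Adj T w u
  T-wu rewrite dec-true (u ≟ u) refl | dec-true (w ≟ w) refl =
    trans (cong (S pw pu ∨_) (∨-zeroʳ _)) (∨-zeroʳ _)

  isPair-cases : ∀ a b → isPair u w a b ≡ true → (a , b) ≡ (u , w) ⊎ (a , b) ≡ (w , u)
  isPair-cases a b h with a ≟ u | b ≟ w | a ≟ w | b ≟ u
  ... | yes refl | yes refl | _        | _        = inj₁ refl
  ... | _        | _        | yes refl | yes refl = inj₂ refl
  isPair-cases a b () | yes _ | no _ | yes _ | no _
  isPair-cases a b () | yes _ | no _ | no _  | _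
  isPair-cases a b () | no _  | _    | yes _ | no _
  isPair-cases a b () | no _  | _    | no _  | _

  T-edge : ∀ {a b} → Adj T a b →
    Adj S (punchIn v a) (punchIn v b) ⊎ ((a , b) ≡ (u , w) ⊎ (a , b) ≡ (w , u))
  T-edge {a} {b} ab with ∨-true {S (punchIn v a) (punchIn v b)} ab
  ... | inj₁ s  = inj₁ s
  ... | inj₂ uw = inj₂ (isPair-cases a b uw)

  -- The T-vertex standing for x as seen from y: vertices other than v keep
  -- their name; v, seen from one of its neighbours, stands for the other.
  contract : Fin (suc n) → Fin (suc n) → Fin n
  contract x y with v ≟ x
  ... | no v≢x = punchOut v≢x
  ... | yes _  = if does (y ≟ pu) then w else u

  image : Fin (suc n) → Fin (suc n) → Fin n × Fin n
  image x y = contract x y , contract y x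

  contract-punchIn : ∀ a y → contract (punchIn v a) y ≡ a
  contract-punchIn a y with v ≟ punchIn v a
  ... | yes v≡a = ⊥-elim (v≢punchIn a v≡a)
  ... | no  _   = trans (punchOut-cong v refl) (punchOut-punchIn v)

  contract-v : ∀ y → contract v y ≡ (if does (y ≟ pu) then w else u)
  contract-v y with v ≟ v
  ... | yes _  = refl
  ... | no v≢v = ⊥-elim (v≢v refl)

  image-away : ∀ a b → image (punchIn v a) (punchIn v b) ≡ (a , b)
  image-away a b = cong₂ _,_ (contract-punchIn a _) (contract-punchIn b _)

  image-v-u : image v pu ≡ (w , u)
  image-v-u rewrite contract-v pu | dec-true (pu ≟ pu) refl = cong (w ,_) (contract-punchIn u v)

  image-v-w : image v pw ≡ (u , w)
  image-v-w rewrite contract-v pw | dec-false (pw ≟ pu) (pu≢pw ∘ sym) =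
    cong (u ,_) (contract-punchIn w v)

  image-u-v : image pu v ≡ (u , w)
  image-u-v = cong swap image-v-u

  image-w-v : image pw v ≡ (w , u)
  image-w-v = cong swap image-v-w

  data EdgeView : Fin (suc n) → Fin (suc n) → Set where
    v-u  : EdgeView v pu
    v-w  : EdgeView v pw
    u-v  : EdgeView pu v
    w-v  : EdgeView pw v
    away : ∀ {a b} → Adj S (punchIn v a) (punchIn v b) → EdgeView (punchIn v a) (punchIn v b)

  view : ∀ {x y} → Adj S x y → EdgeView x y
  view {x} {y} xy with v ≟ x | v ≟ y
  ... | yes refl | yes refl = ⊥-elim (S-irrefl xy)
  ... | yes refl | no _ with degree-two y xy
  ...   | inj₁ refl = v-u
  ...   | inj₂ refl = v-w
  view {x} {y} xy | no _ | yes refl with degree-two x (S-sym xy)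
  ...   | inj₁ refl = u-v
  ...   | inj₂ refl = w-v
  view {x} {y} xy | no v≢x | no v≢y =
    subst₂ EdgeView (punchIn-punchOut v≢x) (punchIn-punchOut v≢y)
      (away (subst₂ (Adj S) (sym (punchIn-punchOut v≢x)) (sym (punchIn-punchOut v≢y)) xy))

  AdjT : Fin n × Fin n → Set
  AdjT (a , b) = Adj T a b

  image-adj : ∀ {x y} → EdgeView x y → AdjT (image x y)
  image-adj v-u               = subst AdjT (sym image-v-u) T-wu
  image-adj v-w               = subst AdjT (sym image-v-w) T-uw
  image-adj u-v               = subst AdjT (sym image-u-v) T-uw
  image-adj w-v               = subst AdjT (sym image-w-v) T-wu
  image-adj (away {a} {b} ab) = subst AdjT (sym (image-away a b)) (S⇒T ab)

  -- An edge of S is recovered from its image and from the side of v.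
  decode : Bool → Fin n × Fin n → Fin (suc n) × Fin (suc n)
  decode vInside (a , b) =
    if S (punchIn v a) (punchIn v b) then (punchIn v a , punchIn v b)
    else if vInside then (v , punchIn v b) else (punchIn v a , v)

  decode-uw : ∀ b → decode b (u , w) ≡ (if b then (v , pw) else (pu , v))
  decode-uw b rewrite S-uw = refl

  decode-wu : ∀ b → decode b (w , u) ≡ (if b then (v , pu) else (pw , v))
  decode-wu b rewrite S-wu = refl

  decode-away : ∀ {a b} c → Adj S (punchIn v a) (punchIn v b) →
    decode c (a , b) ≡ (punchIn v a , punchIn v b)
  decode-away c ab rewrite ab = refl

  decode-image : ∀ X {x y} → Leaves X (x , y) → EdgeView x y →
    decode (lookup X v) (image x y) ≡ (x , y)
  decode-image _ (xv , _) v-u = trans (cong₂ decode xv image-v-u) (decode-wu true)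
  decode-image _ (xv , _) v-w = trans (cong₂ decode xv image-v-w) (decode-uw true)
  decode-image _ (_ , yv) u-v = trans (cong₂ decode yv image-u-v) (decode-uw false)
  decode-image _ (_ , yv) w-v = trans (cong₂ decode yv image-w-v) (decode-wu false)
  decode-image _ _ (away {a} {b} ab) = trans (cong (decode _) (image-away a b)) (decode-away _ ab)

  image-injective : ∀ X {x y x' y'} → Leaves X (x , y) → Adj S x y →
    Leaves X (x' , y') → Adj S x' y' → image x y ≡ image x' y' → (x , y) ≡ (x' , y')
  image-injective X {x} {y} {x'} {y'} l xy l' x'y' eq = begin
    (x , y)                        ≡⟨ sym (decode-image X l (view xy)) ⟩
    decode (lookup X v) (image x y)   ≡⟨ cong (decode (lookup X v)) eq ⟩
    decode (lookup X v) (image x' y') ≡⟨ decode-image X l' (view x'y') ⟩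
    (x' , y')                      ∎
    where open ≡-Reasoning

  res : Subset (suc n) → Subset n
  res X = tabulate (lookup X ∘ punchIn v)

  lookup-res : ∀ X a → lookup (res X) a ≡ lookup X (punchIn v a)
  lookup-res X = lookup∘tabulate (lookup X ∘ punchIn v)

  subset-ext : ∀ {X Y : Subset (suc n)} →
    (∀ a → lookup X (punchIn v a) ≡ lookup Y (punchIn v a)) → lookup X v ≡ lookup Y v → X ≡ Y
  subset-ext {X} {Y} away-v at-v = vec-ext pointwise
    where
    pointwise : ∀ x → lookup X x ≡ lookup Y x
    pointwise x with v ≟ x
    ... | yes refl = at-v
    ... | no v≢x   =
      subst (λ z → lookup X z ≡ lookup Y z) (punchIn-punchOut v≢x) (away-v (punchOut v≢x))

  res-insert : ∀ Y b → res (insertAt Y v b) ≡ Y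
  res-insert Y b = vec-ext λ a → trans (lookup-res (insertAt Y v b) a) (insertAt-punchIn Y v b a)

  insert-res : ∀ X → insertAt (res X) v (lookup X v) ≡ X
  insert-res X = subset-ext (λ a → trans (insertAt-punchIn (res X) v _ a) (lookup-res X a))
                            (insertAt-lookup (res X) v _)

  res-zipWith : ∀ f A B → res (zipWith f A B) ≡ zipWith f (res A) (res B)
  res-zipWith f A B = vec-ext λ a → begin
    lookup (res (zipWith f A B)) a         ≡⟨ lookup-res (zipWith f A B) a ⟩
    lookup (zipWith f A B) (punchIn v a)   ≡⟨ lookup-zipWith f (punchIn v a) A B ⟩
    f (lookup A (punchIn v a)) (lookup B (punchIn v a))
      ≡⟨ sym (cong₂ f (lookup-res A a) (lookup-res B a)) ⟩
    f (lookup (res A) a) (lookup (res B) a) ≡⟨ sym (lookup-zipWith f a (res A) (res B)) ⟩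
    lookup (zipWith f (res A) (res B)) a   ∎
    where open ≡-Reasoning

  res-replicate : ∀ b → res (replicate _ b) ≡ replicate _ b
  res-replicate b = vec-ext λ a → trans (lookup-res (replicate _ b) a)
    (trans (lookup-replicate (punchIn v a) b) (sym (lookup-replicate a b)))

  leaves-res : ∀ X {a b} → Leaves X (punchIn v a , punchIn v b) → Leaves (res X) (a , b)
  leaves-res X {a} {b} (aX , bX) = trans (lookup-res X a) aX , trans (lookup-res X b) bX

  res-leaves : ∀ X {a b} → Leaves (res X) (a , b) → Leaves X (punchIn v a , punchIn v b)
  res-leaves X {a} {b} (aX , bX) = trans (sym (lookup-res X a)) aX , trans (sym (lookup-res X b)) bX

  res-crosses : ∀ A B {a b} →
    Crosses (res A) (res B) (a , b) → Crosses A B (punchIn v a , punchIn v b)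
  res-crosses A B (lA , lB) = res-leaves A lA , res-leaves B lB

  crosses-res : ∀ A B {a b} →
    Crosses A B (punchIn v a , punchIn v b) → Crosses (res A) (res B) (a , b)
  crosses-res A B (lA , lB) = leaves-res A lA , leaves-res B lB

  splitsAt : (Fin (suc n) → Bool) → Bool
  splitsAt χ = splits (χ v) (χ pu) (χ pw)

  splitsAt-cong : ∀ {χ χ'} → (∀ x → χ x ≡ χ' x) → splitsAt χ ≡ splitsAt χ'
  splitsAt-cong eq rewrite eq v | eq pu | eq pw = refl

  Tame : Subset (suc n) → Set
  Tame X = splitsAt (lookup X) ≡ false

  tame-∩ : ∀ A B →
    splits (lookup A v ∧ lookup B v) (lookup A pu ∧ lookup B pu)
           (lookup A pw ∧ lookup B pw) ≡ false → Tame (A ∩ B)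
  tame-∩ A B = trans (splitsAt-cong λ x → lookup-zipWith _∧_ x A B)

  tame-∪ : ∀ A B →
    splits (lookup A v ∨ lookup B v) (lookup A pu ∨ lookup B pu)
           (lookup A pw ∨ lookup B pw) ≡ false → Tame (A ∪ B)
  tame-∪ A B = trans (splitsAt-cong λ x → lookup-zipWith _∨_ x A B)

  tame-res-constant : ∀ {X} b → Tame X → res X ≡ replicate _ b → X ≡ replicate _ b
  tame-res-constant {X} b tame resX≡b =
    subset-ext (λ a → trans (on-punchIn a) (sym (lookup-replicate (punchIn v a) b)))
               (trans at-v (sym (lookup-replicate v b)))
    where
    on-punchIn : ∀ a → lookup X (punchIn v a) ≡ b
    on-punchIn a = begin
      lookup X (punchIn v a)   ≡⟨ sym (lookup-res X a) ⟩
      lookup (res X) a         ≡⟨ cong (λ Z → lookup Z a) resX≡b ⟩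
      lookup (replicate _ b) a ≡⟨ lookup-replicate a b ⟩
      b                        ∎
      where open ≡-Reasoning
    at-v : lookup X v ≡ b
    at-v = unsplit-both b
      (subst₂ (λ c d → splits (lookup X v) c d ≡ false) (on-punchIn u) (on-punchIn w) tame)

  image-leaves : ∀ X {x y} → Tame X → Leaves X (x , y) → EdgeView x y → Leaves (res X) (image x y)
  image-leaves X t (xv , xu) v-u =
    subst (Leaves (res X)) (sym image-v-u) (leaves-res X (unsplit-u true t xv xu , xu))
  image-leaves X t (xv , xw) v-w =
    subst (Leaves (res X)) (sym image-v-w) (leaves-res X (unsplit-w true t xv xw , xw))
  image-leaves X t (xu , xv) u-v =
    subst (Leaves (res X)) (sym image-u-v) (leaves-res X (xu , unsplit-u false t xv xu))
  image-leaves X t (xw , xv) w-v =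
    subst (Leaves (res X)) (sym image-w-v) (leaves-res X (xw , unsplit-w false t xv xw))
  image-leaves X t l (away {a} {b} _) =
    subst (Leaves (res X)) (sym (image-away a b)) (leaves-res X l)

  leaving-image : ∀ X {x y} → Tame X → InD S X (x , y) → InD T (res X) (image x y)
  leaving-image X t d with InD⇒Leaves S X d
  ... | l , xy = Leaves⇒InD T (res X) (image-leaves X t l (view xy)) (image-adj (view xy))

  crossing-image : ∀ A B {x y} → Tame A → Tame B →
    InD₂ S A B (x , y) → InD₂ T (res A) (res B) (image x y)
  crossing-image A B tA tB c with InD₂⇒Crosses S A B c
  ... | (lA , lB) , xy = Crosses⇒InD₂ T (res A) (res B)
    (image-leaves A tA lA (view xy) , image-leaves B tB lB (view (S-sym xy))) (image-adj (view xy))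

  crossing-decode : ∀ A B {x y} →
    InD₂ S A B (x , y) → (x , y) ≡ decode (lookup A v) (image x y)
  crossing-decode A B c with InD₂⇒Crosses S A B c
  ... | ((l , _) , xy) = sym (decode-image A l (view xy))

  uw-preimage : ∀ A B {x y} → (∀ {x y} → InD₂ S A B (x , y) → image x y ≡ (u , w)) →
    InD₂ S A B (x , y) → (x , y) ≡ (if lookup A v then (v , pw) else (pu , v))
  uw-preimage A B to-uw c =
    trans (crossing-decode A B c) (trans (cong (decode _) (to-uw c)) (decode-uw _))

  big-res : ∀ X → Tame X → DAtLeast2 S X → DAtLeast2 T (res X)
  big-res X t ((x , y) , (x' , y') , d , d' , e≢e') =
    image x y , image x' y' , leaving-image X t d , leaving-image X t d' ,
    λ eq → e≢e' (image-injective X (proj₁ (InD⇒Leaves S X d)) (proj₂ (InD⇒Leaves S X d))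
                                   (proj₁ (InD⇒Leaves S X d')) (proj₂ (InD⇒Leaves S X d')) eq)

  meet-join-tame : ∀ A B → Tame A → Tame B →
    ¬ Crosses A B (pu , pw) → ¬ Crosses A B (pw , pu) → Tame (A ∩ B) × Tame (A ∪ B)
  meet-join-tame A B tA tB ¬uw ¬wu =
    let meet , join = meet-join-unsplit (lookup A v) (lookup A pu) (lookup A pw)
                                        (lookup B v) (lookup B pu) (lookup B pw) tA tB ¬uw ¬wu
    in tame-∩ A B meet , tame-∪ A B join

  meet-tame-uw : ∀ A B → Crosses A B (pu , pw) →
    lookup A v ∧ lookup B v ≡ false → Tame (A ∩ B)
  meet-tame-uw A B ((au , aw) , (_ , bu)) v∉ = tame-∩ A B outside
    where
    outside : splits (lookup A v ∧ lookup B v) (lookup A pu ∧ lookup B pu)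
                     (lookup A pw ∧ lookup B pw) ≡ false
    outside rewrite au | aw | bu = trans (splits-outside _) v∉

  join-tame-uw : ∀ A B → Crosses A B (pu , pw) →
    lookup A v ∨ lookup B v ≡ true → Tame (A ∪ B)
  join-tame-uw A B ((au , aw) , (bw , _)) v∈ = tame-∪ A B inside
    where
    inside : splits (lookup A v ∨ lookup B v) (lookup A pu ∨ lookup B pu)
                    (lookup A pw ∨ lookup B pw) ≡ false
    inside rewrite au | aw | bw = trans (splits-inside _) (cong not v∈)

  module Restricted (𝓑 : SetOfSubsets (suc n)) (bias : IsBias S 𝓑) where

    tame-member : Subset (suc n) → Bool
    tame-member X = 𝓑 X ∧ not (splitsAt (lookup X))

    -- 𝓑' consists of the restrictions of the tame members of 𝓑.
    𝓑' : SetOfSubsets n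
    𝓑' Y = tame-member (insertAt Y v false) ∨ tame-member (insertAt Y v true)

    res-∈ : ∀ X → X ∈B 𝓑 → Tame X → res X ∈B 𝓑'
    res-∈ X X∈ t = from-insert (lookup X v)
      (subst (λ Z → tame-member Z ≡ true) (sym (insert-res X))
             (cong₂ (λ b c → b ∧ not c) X∈ t))
      where
      from-insert : ∀ b → tame-member (insertAt (res X) v b) ≡ true → res X ∈B 𝓑'
      from-insert false h = cong (_∨ tame-member (insertAt (res X) v true)) h
      from-insert true  h = trans (cong (tame-member (insertAt (res X) v false) ∨_) h) (∨-zeroʳ _)

    ∈-res : ∀ {Y} → Y ∈B 𝓑' → Σ _ λ X → X ∈B 𝓑 × Tame X × res X ≡ Y
    ∈-res {Y} h with ∨-true {tame-member (insertAt Y v false)} h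
    ... | inj₁ m = _ , proj₁ (∧-true m) , not-true (proj₂ (∧-true m)) , res-insert Y false
    ... | inj₂ m = _ , proj₁ (∧-true m) , not-true (proj₂ (∧-true m)) , res-insert Y true

    res-∈⁺ : ∀ X → X ∈B⁺ 𝓑 → Tame X → res X ∈B⁺ 𝓑'
    res-∈⁺ X (inj₁ X∈)          t = inj₁ (res-∈ X X∈ t)
    res-∈⁺ _ (inj₂ (inj₁ refl)) _ = inj₂ (inj₁ (res-replicate false))
    res-∈⁺ _ (inj₂ (inj₂ refl)) _ = inj₂ (inj₂ (res-replicate true))

    meet-∈⁺ : ∀ A B → (A ∩ B) ∈B⁺ 𝓑 → Tame (A ∩ B) → (res A ∩ res B) ∈B⁺ 𝓑'
    meet-∈⁺ A B h t = subst (_∈B⁺ 𝓑') (res-zipWith _∧_ A B) (res-∈⁺ (A ∩ B) h t)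

    join-∈⁺ : ∀ A B → (A ∪ B) ∈B⁺ 𝓑 → Tame (A ∪ B) → (res A ∪ res B) ∈B⁺ 𝓑'
    join-∈⁺ A B h t = subst (_∈B⁺ 𝓑') (res-zipWith _∨_ A B) (res-∈⁺ (A ∪ B) h t)

    MeetOrJoin' : Subset (suc n) → Subset (suc n) → Set
    MeetOrJoin' A B = (res A ∩ res B) ∈B⁺ 𝓑' ⊎ (res A ∪ res B) ∈B⁺ 𝓑'

    meet-or-join-∈⁺ : ∀ A B → Tame (A ∩ B) → Tame (A ∪ B) →
      (A ∩ B) ∈B⁺ 𝓑 ⊎ (A ∪ B) ∈B⁺ 𝓑 → MeetOrJoin' A B
    meet-or-join-∈⁺ A B t∩ _  (inj₁ h) = inj₁ (meet-∈⁺ A B h t∩)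
    meet-or-join-∈⁺ A B _  t∪ (inj₂ h) = inj₂ (join-∈⁺ A B h t∪)

    S-empty : ∀ A B → A ∈B 𝓑 → B ∈B 𝓑 → D₂Empty S A B →
      (A ∩ B) ∈B⁺ 𝓑 × (A ∪ B) ∈B⁺ 𝓑
    S-empty = proj₁ (proj₂ bias)

    S-single : ∀ A B → A ∈B 𝓑 → B ∈B 𝓑 → D₂Single S A B →
      (A ∩ B) ∈B⁺ 𝓑 ⊎ (A ∪ B) ∈B⁺ 𝓑
    S-single = proj₂ (proj₂ bias)

    -- Condition (i): a tame set with empty (full) restriction is empty (full).
    bias-i : ∀ Y → Y ∈B 𝓑' → Y ≢ ⊥ × Y ≢ ⊤
    bias-i _ h with ∈-res h
    ... | X , X∈ , t , refl = (proj₁ (proj₁ bias X X∈) ∘ tame-res-constant false t)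
                            , (proj₂ (proj₁ bias X X∈) ∘ tame-res-constant true t)

    -- Condition (ii): D_T(A', B') = ∅ forces D_S(A, B) = ∅ and tameness of A ∩ B, A ∪ B.
    bias-ii : ∀ Y Z → Y ∈B 𝓑' → Z ∈B 𝓑' → D₂Empty T Y Z →
      (Y ∩ Z) ∈B⁺ 𝓑' × (Y ∪ Z) ∈B⁺ 𝓑'
    bias-ii _ _ hY hZ empty with ∈-res hY | ∈-res hZ
    ... | A , A∈ , tA , refl | B , B∈ , tB , refl =
      meet-∈⁺ A B (proj₁ in-𝓑) (proj₁ tame) , join-∈⁺ A B (proj₂ in-𝓑) (proj₂ tame)
      where
      tame : Tame (A ∩ B) × Tame (A ∪ B)
      tame = meet-join-tame A B tA tB
        (λ c → empty (u , w) (Crosses⇒InD₂ T (res A) (res B) (crosses-res A B c) T-uw))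
        (λ c → empty (w , u) (Crosses⇒InD₂ T (res A) (res B) (crosses-res A B c) T-wu))
      in-𝓑 : (A ∩ B) ∈B⁺ 𝓑 × (A ∪ B) ∈B⁺ 𝓑
      in-𝓑 = S-empty A B A∈ B∈ λ { (x , y) c → empty (image x y) (crossing-image A B tA tB c) }

    -- Condition (iii) when the unique T-crossing is an edge ab of S - v:
    -- then D_S(A, B) = {ab}, and uw does not cross.
    single-away : ∀ A B {a b} → A ∈B 𝓑 → Tame A → B ∈B 𝓑 → Tame B →
      Adj S (punchIn v a) (punchIn v b) → InD₂ T (res A) (res B) (a , b) →
      (∀ e → InD₂ T (res A) (res B) e → e ≡ (a , b)) → MeetOrJoin' A B
    single-away A B {a} {b} A∈ tA B∈ tB ab c unique =
      meet-or-join-∈⁺ A B (proj₁ tame) (proj₂ tame) (S-single A B A∈ B∈ (_ , lifted , forced))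
      where
      lifted : InD₂ S A B (punchIn v a , punchIn v b)
      lifted = Crosses⇒InD₂ S A B (res-crosses A B (proj₁ (InD₂⇒Crosses T (res A) (res B) c))) ab
      forced : ∀ e → InD₂ S A B e → e ≡ (punchIn v a , punchIn v b)
      forced (x , y) c' = trans (crossing-decode A B c')
        (trans (cong (decode _) (unique _ (crossing-image A B tA tB c'))) (decode-away _ ab))
      no-uw : ¬ Crosses A B (pu , pw)
      no-uw cr with unique (u , w) (Crosses⇒InD₂ T (res A) (res B) (crosses-res A B cr) T-uw)
      ... | refl = u≁w ab
      no-wu : ¬ Crosses A B (pw , pu)
      no-wu cr with unique (w , u) (Crosses⇒InD₂ T (res A) (res B) (crosses-res A B cr) T-wu)
      ... | refl = u≁w (S-sym ab)
      tame : Tame (A ∩ B) × Tame (A ∪ B)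
      tame = meet-join-tame A B tA tB no-uw no-wu

    -- Condition (iii) when the unique T-crossing is uw, from A to B: D_S(A, B)
    -- is {vw}, {uv} or empty according to the side of v, and correspondingly
    -- both A ∩ B and A ∪ B, or one of them, are tame.
    single-uw : ∀ A B → A ∈B 𝓑 → Tame A → B ∈B 𝓑 → Tame B → Crosses A B (pu , pw) →
      (∀ {x y} → InD₂ S A B (x , y) → image x y ≡ (u , w)) → MeetOrJoin' A B
    single-uw A B A∈ tA B∈ tB uw@((au , aw) , (bw , bu)) to-uw =
      by-side (lookup A v) (lookup B v) refl refl
      where
      forced : ∀ {x y} b → lookup A v ≡ b → InD₂ S A B (x , y) →
        (x , y) ≡ (if b then (v , pw) else (pu , v))
      forced b av c =
        trans (uw-preimage A B to-uw c) (cong (λ b → if b then (v , pw) else (pu , v)) av)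
      by-side : ∀ a b → lookup A v ≡ a → lookup B v ≡ b → MeetOrJoin' A B
      by-side true false av bv = meet-or-join-∈⁺ A B
        (meet-tame-uw A B uw (cong₂ _∧_ av bv)) (join-tame-uw A B uw (cong₂ _∨_ av bv))
          (S-single A B A∈ B∈ (_ , Crosses⇒InD₂ S A B ((av , aw) , (bw , bv)) v~w ,
                               λ { (x , y) c → forced true av c }))
      by-side false true av bv = meet-or-join-∈⁺ A B
        (meet-tame-uw A B uw (cong₂ _∧_ av bv)) (join-tame-uw A B uw (cong₂ _∨_ av bv))
          (S-single A B A∈ B∈ (_ , Crosses⇒InD₂ S A B ((au , av) , (bv , bu)) (S-sym v~u) ,
                               λ { (x , y) c → forced false av c }))
      by-side true true av bv =
        inj₂ (join-∈⁺ A B (proj₂ (S-empty A B A∈ B∈ no-crossing))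
                          (join-tame-uw A B uw (cong₂ _∨_ av bv)))
        where
        no-crossing : D₂Empty S A B
        no-crossing (x , y) c with forced true av c | InD₂⇒Crosses S A B c
        ... | refl | (_ , (_ , v∉B)) , _ = true≢false (trans (sym bv) v∉B)
      by-side false false av bv =
        inj₁ (meet-∈⁺ A B (proj₁ (S-empty A B A∈ B∈ no-crossing))
                          (meet-tame-uw A B uw (cong₂ _∧_ av bv)))
        where
        no-crossing : D₂Empty S A B
        no-crossing (x , y) c with forced false av c | InD₂⇒Crosses S A B c
        ... | refl | (_ , (v∈B , _)) , _ = true≢false (trans (sym v∈B) bv)

    -- Condition (iii): the unique T-crossing is an edge of S - v, or uw in one
    -- of its two orientations (the second reduces to the first by swapping).
    bias-iii : ∀ Y Z → Y ∈B 𝓑' → Z ∈B 𝓑' → D₂Single T Y Z →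
      (Y ∩ Z) ∈B⁺ 𝓑' ⊎ (Y ∪ Z) ∈B⁺ 𝓑'
    bias-iii _ _ hY hZ ((a , b) , c , unique) with ∈-res hY | ∈-res hZ
    ... | A , A∈ , tA , refl | B , B∈ , tB , refl with T-edge (proj₂ (proj₂ c))
    ... | inj₁ ab          = single-away A B A∈ tA B∈ tB ab c unique
    ... | inj₂ (inj₁ refl) =
      single-uw A B A∈ tA B∈ tB (res-crosses A B (proj₁ (InD₂⇒Crosses T (res A) (res B) c)))
                (λ c' → unique _ (crossing-image A B tA tB c'))
    ... | inj₂ (inj₂ refl) = commute
      (single-uw B A B∈ tB A∈ tA (swap (res-crosses A B (proj₁ (InD₂⇒Crosses T (res A) (res B) c))))
        (λ c' → cong swap (unique _ (crossing-image A B tA tB (crossing-swap S-sym c')))))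
      where
      commute : MeetOrJoin' B A → MeetOrJoin' A B
      commute (inj₁ h) = inj₁ (subst (_∈B⁺ 𝓑') (∩-comm (res B) (res A)) h)
      commute (inj₂ h) = inj₂ (subst (_∈B⁺ 𝓑') (∪-comm (res B) (res A)) h)

    bias-T : IsBias T 𝓑'
    bias-T = bias-i , bias-ii , bias-iii

    big-T : (∀ X → X ∈B 𝓑 → DAtLeast2 S X) → ∀ Y → Y ∈B 𝓑' → DAtLeast2 T Y
    big-T big _ h with ∈-res h
    ... | X , X∈ , t , refl = big-res X t (big X X∈)

  open Restricted using (𝓑'; res-∈; bias-T; big-T)

  module Lift (arcT : Fin n → Fin n → Bool) (directed : IsDirecting T arcT) where

    ArcT : Fin n × Fin n → Bool
    ArcT (a , b) = arcT a b

    arc : Fin (suc n) → Fin (suc n) → Bool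
    arc x y = S x y ∧ ArcT (image x y)

    -- Since image y x is image x y reversed, this orients each edge of S exactly once.
    arc-directing : IsDirecting S arc
    arc-directing = oriented , λ x y h → proj₁ (∧-true h)
      where
      oriented : ∀ x y → Adj S x y →
        (arc x y ≡ true × arc y x ≡ false) ⊎ (arc x y ≡ false × arc y x ≡ true)
      oriented x y xy with proj₁ directed _ _ (image-adj (view xy))
      ... | inj₁ (t , f) = inj₁ (cong₂ _∧_ xy t , cong₂ _∧_ (S-sym xy) f)
      ... | inj₂ (f , t) = inj₂ (cong₂ _∧_ xy f , cong₂ _∧_ (S-sym xy) t)

    through-v : ∀ {p q} → (p , q) ≡ (u , w) ⊎ (p , q) ≡ (w , u) → arcT p q ≡ true →
      arc (punchIn v p) v ≡ true × arc v (punchIn v q) ≡ true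
    through-v (inj₁ refl) t = cong₂ _∧_ (S-sym v~u) (trans (cong ArcT image-u-v) t)
                            , cong₂ _∧_ v~w (trans (cong ArcT image-v-w) t)
    through-v (inj₂ refl) t = cong₂ _∧_ (S-sym v~w) (trans (cong ArcT image-w-v) t)
                            , cong₂ _∧_ v~u (trans (cong ArcT image-v-u) t)

    lift-leaving : ∀ (χ : Fin (suc n) → Bool) {a b} → arcT a b ≡ true →
      χ (punchIn v a) ≡ true → χ (punchIn v b) ≡ false →
      Σ _ λ x → Σ _ λ y → χ x ≡ true × χ y ≡ false × arc x y ≡ true
    lift-leaving χ {a} {b} t χa χb with T-edge (proj₂ directed a b t)
    ... | inj₁ ab = _ , _ , χa , χb , cong₂ _∧_ ab (trans (cong ArcT (image-away a b)) t)
    ... | inj₂ uw with through-v uw t | χ v in χv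
    ...   | _  , vb | true  = v , _ , χv , χb , vb
    ...   | av , _  | false = _ , v , χa , χv , av

    out-of : ∀ X {x y} → Leaves X (x , y) → arc x y ≡ true → OutNonempty arc X
    out-of X (x-in , y-out) xy = _ , _ , true⇒∈ x-in , false⇒∉ y-out , xy

    into : ∀ X {x y} → Leaves X (x , y) → arc y x ≡ true → InNonempty arc X
    into X (x-in , y-out) yx = _ , _ , true⇒∈ x-in , false⇒∉ y-out , yx

    lift-out : ∀ X → OutNonempty arcT (res X) → OutNonempty arc X
    lift-out X (a , b , a∈ , b∉ , t) with res-leaves X (∈⇒true a∈ , ∉⇒false b∉)
    ... | Xa , Xb with lift-leaving (lookup X) t Xa Xb
    ...   | _ , _ , Xx , Xy , xy = out-of X (Xx , Xy) xy

    lift-in : ∀ X → InNonempty arcT (res X) → InNonempty arc X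
    lift-in X (a , b , a∈ , b∉ , t) with res-leaves X (∈⇒true a∈ , ∉⇒false b∉)
    ... | Xa , Xb with lift-leaving (not ∘ lookup X) t (cong not Xb) (cong not Xa)
    ...   | _ , _ , Xx , Xy , xy = into X (not-false Xy , not-true Xx) xy

    path-both-ways : ∀ X {p q} → (p , q) ≡ (u , w) ⊎ (p , q) ≡ (w , u) → arcT p q ≡ true →
      lookup X (punchIn v p) ≡ not (lookup X v) → lookup X (punchIn v q) ≡ not (lookup X v) →
      ∀ b → lookup X v ≡ b → OutNonempty arc X × InNonempty arc X
    path-both-ways X uw t Xp Xq true  Xv =
      out-of X (Xv , trans Xq (cong not Xv)) (proj₂ (through-v uw t)) ,
      into   X (Xv , trans Xp (cong not Xv)) (proj₁ (through-v uw t))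
    path-both-ways X uw t Xp Xq false Xv =
      out-of X (trans Xp (cong not Xv) , Xv) (proj₁ (through-v uw t)) ,
      into   X (trans Xq (cong not Xv) , Xv) (proj₂ (through-v uw t))

    split-both-ways : ∀ X → splitsAt (lookup X) ≡ true → OutNonempty arc X × InNonempty arc X
    split-both-ways X split with split-sides (lookup X v) split | proj₁ directed u w T-uw
    ... | Xu , Xw | inj₁ (t , _) = path-both-ways X (inj₁ refl) t Xu Xw (lookup X v) refl
    ... | Xu , Xw | inj₂ (_ , t) = path-both-ways X (inj₂ refl) t Xw Xu (lookup X v) refl

    both-ways : ∀ 𝓑 bias →
      (∀ Y → Y ∈B 𝓑' 𝓑 bias → OutNonempty arcT Y × InNonempty arcT Y) →
      ∀ X → X ∈B 𝓑 → OutNonempty arc X × InNonempty arc X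
    both-ways 𝓑 bias crossed X X∈ with splitsAt (lookup X) in split
    ... | true  = split-both-ways X split
    ... | false = let out , in′ = crossed (res X) (res-∈ 𝓑 bias X X∈ split)
                  in lift-out X out , lift-in X in′

  upright : Upright T → Upright S
  upright upright-T 𝓑 bias big
    with upright-T (𝓑' 𝓑 bias) (bias-T 𝓑 bias) (big-T 𝓑 bias big)
  ... | arcT , directed , crossed = arc , arc-directing , both-ways 𝓑 bias crossed
    where open Lift arcT directed

mainTheorem3 : ∀ (n : ℕ) (S : Graph (suc n)) (v : Fin (suc n)) (u w : Fin n) →
    IsTree S →
    Adj S v (punchIn v u) → Adj S v (punchIn v w) → u ≢ w →
    (∀ x → Adj S v x → x ≡ punchIn v u ⊎ x ≡ punchIn v w) →
    Upright (suppress S v u w) → Upright S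
mainTheorem3 n S v u w (simple , _ , acyclic) v~u v~w u≢w degree-two =
  Suppression.upright S v u w simple v~u v~w u≢w degree-two no-triangle
  where
  no-triangle : ¬ Adj S (punchIn v u) (punchIn v w)
  no-triangle u~w = acyclic (triangle {G = S}
    (punchInᵢ≢i v u ∘ sym) (u≢w ∘ punchIn-injective v u w) (punchInᵢ≢i v w ∘ sym)
    v~u u~w (trans (proj₁ simple _ _) v~w))
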